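{- Let $k\geq 3$ and $t\geq 2$ be integers and let $T=K_{1,t-1}$ be the star with $t$ vertices. Then $M_{F^{(k)}(T)}(n)\geq t-1$ for all sufficiently large $n$.
   Context: A $k$-uniform hypergraph ($k$-graph) $H$ consists of a vertex set $V(H)$ and an edge set $E(H)\subseteq V(H)^{(k)}=\{S\subseteq V(H): |S|=k\}$. For $k$-graphs $F$ and $H$, a copy of $F$ in $H$ is a subhypergraph of $H$ isomorphic to $F$, and $c(F,H)$ denotes the number of copies of $F$ in $H$. For a $k$-graph $F$ and a $k$-graph $H$, the $F$-bootstrap percolation process ($F$-process) starting with $H$ is the sequence $(H_i)_{i\geq 0}$ of $k$-graphs on vertex set $V(H)$ defined by $H_0=H$ and $E(H_{i+1})=E(H_i)\cup\{e\in V(H)^{(k)}: c(F,H_i\cup e)>c(F,H_i)\}$, where $H_i\cup e$ is the $k$-graph $(V(H),E(H_i)\cup\{e\})$. The running time is $\tau_F(H)=\min\{t\in\mathbb{N}_{\geq 0}: H_t=H_{t+1}\}$, and $M_F(n)=\max\{\tau_F(H): H \text{ is a } k\text{ -graph with } n \text{ vertices}\}$. For a graph $G=(V,E)$ and an integer $k\ge 3$, the $k$-extension $F^{(k)}(G)$ is the $k$-graph with vertex set $V\,\dot\cup\,\{v_e^i: i\in[k-2], e\in E\}$ (all $v_e^i$ distinct new vertices) and edge set $\{e\cup\{v_e^1,\dots,v_e^{k-2}\}: e\in E\}$. $K_{1,t-1}$ denotes the star graph with one center vertex adjacent to $t-1$ leaves. -}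

module Defs where

open import Data.Nat using (ℕ; zero; suc; _≤_; _<_; _∸_)
open import Data.Bool using (Bool; true; false; T)
open import Data.Fin using (Fin)
open import Data.Fin.Subset using (Subset; _∈_; _⊆_; ∣_∣)
open import Data.Vec using ([]; _∷_; lookup)
open import Data.Maybe using (Maybe; nothing; just)
open import Data.Product using (Σ; _×_; _,_; proj₁; proj₂)
open import Data.Sum using (_⊎_; inj₁; inj₂)
open import Data.List using (List; length)
open import Data.List.Membership.Propositional renaming (_∈_ to _∈L_)
open import Data.List.Relation.Unary.Unique.Propositional using (Unique)
open import Function.Bundles using (_⇔_; _↔_; Inverse)
open import Relation.Binary.PropositionalEquality using (_≡_; _≢_)

-- Finite sets of subsets of Fin n, in a canonical representation
-- (a binary trie): two families are equal iff they are ≡.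

Fam : ℕ → Set
Fam zero = Bool
Fam (suc n) = Fam n × Fam n

infix 4 _∈F_
_∈F_ : ∀ {n} → Subset n → Fam n → Set
_∈F_ {zero} [] b = T b
_∈F_ {suc n} (false ∷ s) (l , r) = s ∈F l
_∈F_ {suc n} (true ∷ s) (l , r) = s ∈F r

insertF : ∀ {n} → Subset n → Fam n → Fam n
insertF {zero} [] b = true
insertF {suc n} (false ∷ s) (l , r) = insertF s l , r
insertF {suc n} (true ∷ s) (l , r) = l , insertF s r

IsKGraph : ℕ → ∀ {n} → Fam n → Set
IsKGraph k {n} E = ∀ (S : Subset n) → S ∈F E → ∣ S ∣ ≡ k

record Hypergraph : Set₁ where
  field
    Vtx    : Set
    IsEdge : (Vtx → Bool) → Set
open Hypergraph public

SubHG : ℕ → Set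
SubHG n = Subset n × Fam n

-- (V' , E') is a copy of F in the hypergraph on Fin n with edge set H:
-- E' ⊆ H, every edge of E' lies inside V', and there is a bijection
-- φ : V(F) → V' with  X ∈ E(F) ⇔ φ(X) ∈ E'  (written via preimages:
-- every X ⊆ V(F) is φ⁻¹(S) for a unique S ⊆ V').
IsCopy : (F : Hypergraph) → ∀ {n} → Fam n → SubHG n → Set
IsCopy F {n} H (V' , E') =
  (∀ (S : Subset n) → S ∈F E' → (S ∈F H) × (S ⊆ V')) ×
  Σ (Vtx F ↔ Σ (Fin n) (λ v → v ∈ V')) λ φ →
    ∀ (S : Subset n) → S ⊆ V' →
      (S ∈F E' ⇔ IsEdge F (λ x → lookup S (proj₁ (Inverse.to φ x))))

HasCount : {A : Set} → (A → Set) → ℕ → Set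
HasCount {A} P m =
  Σ (List A) λ xs → Unique xs × (length xs ≡ m) × (∀ x → (x ∈L xs) ⇔ P x)

CountIncreases : (F : Hypergraph) → ∀ {n} → Fam n → Subset n → Set
CountIncreases F H S =
  Σ ℕ λ m → Σ ℕ λ m' →
    HasCount (IsCopy F H) m × HasCount (IsCopy F (insertF S H)) m' × (m < m')

Step : ℕ → Hypergraph → ∀ {n} → Fam n → Fam n → Set
Step k F {n} E E' =
  ∀ (S : Subset n) → S ∈F E' ⇔ (S ∈F E ⊎ ((∣ S ∣ ≡ k) × CountIncreases F E S))

IsProcess : ℕ → Hypergraph → ∀ {n} → Fam n → (ℕ → Fam n) → Set
IsProcess k F H Hs = (Hs 0 ≡ H) × (∀ i → Step k F (Hs i) (Hs (suc i)))

IsRunningTime : ∀ {n} → (ℕ → Fam n) → ℕ → Set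
IsRunningTime Hs τ = (Hs τ ≡ Hs (suc τ)) × (∀ i → i < τ → Hs i ≢ Hs (suc i))

-- M_F(n) ≥ s, i.e. max over k-graphs H on n vertices of τ_F(H) is ≥ s.
MAtLeast : ℕ → Hypergraph → ℕ → ℕ → Set
MAtLeast k F n s =
  Σ (Fam n) λ H → IsKGraph k H ×
  Σ (ℕ → Fam n) λ Hs → IsProcess k F H Hs ×
  Σ ℕ λ τ → IsRunningTime Hs τ × (s ≤ τ)

record Graph : Set₁ where
  field
    GV   : Set
    GE   : Set
    ends : GE → GV × GV
open Graph public

-- F^(k)(G): vertices V ⊎ {v_e^i : e ∈ E, i ∈ [k-2]},
-- edges e ∪ {v_e^1 , … , v_e^(k-2)}.
ExtV : Graph → ℕ → Set
ExtV G k = GV G ⊎ (GE G × Fin (k ∸ 2))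

InExtEdge : (G : Graph) (k : ℕ) → ExtV G k → GE G → Set
InExtEdge G k (inj₁ v) e = (v ≡ proj₁ (ends G e)) ⊎ (v ≡ proj₂ (ends G e))
InExtEdge G k (inj₂ (e' , i)) e = e' ≡ e

kExtension : ℕ → Graph → Hypergraph
kExtension k G = record
  { Vtx = ExtV G k
  ; IsEdge = λ X → Σ (GE G) λ e → ∀ x → (T (X x) ⇔ InExtEdge G k x e)
  }

-- K_{1,t-1}: centre = nothing, leaves just j (j : Fin (t-1)),
-- edges j ↦ {centre , leaf j}.
Star : ℕ → Graph
Star t = record
  { GV = Maybe (Fin (t ∸ 1))
  ; GE = Fin (t ∸ 1)
  ; ends = λ j → nothing , just j
  }

{-# OPTIONS --safe #-}

-- Write t = t' + 2 and k = k' + 3, and take t core vertices 0, …, t' + 1 (the last one is `last`).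
-- The initial k-graph consists of the pendant edges P(j, a), j < a ≤ t', each made of core j and
-- k − 1 private vertices; for j < m let L(j, m) consist of cores j and m and k − 2 private vertices.
-- The copy of F centred at core j whose leaves a < j, j and a > j span L(a, j), L(j, m) and P(j, a)
-- shows, by induction on j, that L(j, m) is present at time j + 1.
-- Conversely, while i + 3 ≤ t every edge present at time i is initial or contains a core below i.
-- Otherwise a new edge e completes a copy whose t' + 1 edges pairwise meet only in the centre, and
-- the t' edges other than e would all be pierced outside the centre by fewer than t' vertices
-- (the cores below i and suitable pendant vertices), contradicting the pigeonhole principle.
-- Since L(j, last) is not initial and avoids the cores below j, the process still grows at every
-- time i ≤ t', so the running time is at least t − 1.
module Submission where

open import Defs
open import Level using (0ℓ)
open import Data.Bool using (true; false; T; if_then_else_)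
open import Data.Bool.Properties using (T-≡) renaming (_≟_ to _≟ᵇ_)
open import Data.Empty using (⊥; ⊥-elim)
open import Data.Fin using (Fin; zero; suc; toℕ; fromℕ; fromℕ<; inject₁; inject≤; punchIn; _↑ˡ_; _↑ʳ_; splitAt; remQuot; combine)
  renaming (_<_ to _<ᶠ_; _≟_ to _≟ᶠ_)
open import Data.Fin.Properties using (any?; all?; ¬∀⟶∃¬; pigeonhole; punchInᵢ≢i; punchIn-injective; fromℕ<-injective; toℕ-injective; toℕ-inject₁; toℕ-fromℕ; toℕ-fromℕ<; toℕ<n; inject≤-injective; splitAt-↑ˡ; splitAt-↑ʳ; remQuot-combine)
open import Data.Fin.Subset using (Subset; _∈_; _∉_; _⊆_; ∣_∣; ⁅_⁆; _∪_; inside; outside) renaming (⊥ to ∅)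
open import Data.Fin.Subset.Properties using (_∈?_; ∉⊥; ∣⊥∣≡0; x∈⁅x⁆; x∈⁅y⁆⇒x≡y; x∈p∪q⁺; x∈p∪q⁻; ∪-identityˡ; ∪-assoc; ∪-comm; ⊆-antisym)
open import Data.List using (List; []; _∷_; length; map; filter; tabulate; allFin; _++_; cartesianProductWith; deduplicate)
import Data.List as List
open import Data.List.Membership.Propositional using (find) renaming (_∈_ to _∈L_; _∉_ to _∉L_)
open import Data.List.Membership.Propositional.Properties using (∈-map⁺; ∈-map⁻; ∈-tabulate⁺; ∈-tabulate⁻; ∈-allFin; ∈-++⁺ˡ; ∈-++⁺ʳ; ∈-cartesianProductWith⁺; ∈-filter⁺; ∈-filter⁻; ∈-deduplicate⁺; ∈-deduplicate⁻)
open import Data.List.Properties using (filter-notAll; length-map; length-tabulate; map-cong; map-cong-local)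
open import Data.List.Relation.Unary.All as All using (All; _∷_)
open import Data.List.Relation.Unary.All.Properties as AllP using (¬All⇒Any¬)
open import Data.List.Relation.Unary.Any as Any using (here; there)
open import Data.List.Relation.Unary.Any.Properties using (lookup-index)
open import Data.List.Relation.Unary.Unique.Propositional using (Unique; _∷_)
open import Data.List.Relation.Unary.Unique.Propositional.Properties as UniqueP using ()
open import Data.List.Relation.Unary.Unique.DecPropositional.Properties using (deduplicate-!)
open import Data.Maybe using (nothing; just)
open import Data.Maybe.Properties using () renaming (≡-dec to Maybe-≡-dec)
open import Data.Nat using (ℕ; zero; suc; _+_; _*_; _∸_; _^_; _≤_; _<_; z≤n; s≤s; s≤s⁻¹; pred; _<?_) renaming (_≟_ to _≟ℕ_)
open import Data.Nat.Induction using (<-rec)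
open import Data.Nat.Properties using (≤-refl; ≤-trans; <-irrefl; <-asym; <-≤-trans; ≤⇒≯; ≰⇒>; ≮⇒≥; n≤1+n; m≤m+n; m≤n⇒m<n∨m≡n; +-mono-≤; +-cancelʳ-≤; +-cancelˡ-≤; +-monoʳ-≤; +-monoˡ-≤; anyUpTo?)
import Data.Nat.Properties as ℕ
open import Data.Product using (Σ; ∃; ∃₂; _×_; _,_; proj₁; proj₂; uncurry)
open import Data.Product.Properties using () renaming (≡-dec to ×-≡-dec)
open import Data.Sum using (_⊎_; inj₁; inj₂; [_,_])
open import Data.Sum.Properties using () renaming (≡-dec to ⊎-≡-dec)
open import Data.Unit using (tt)
open import Data.Vec using (Vec; []; _∷_; here; there; lookup)
import Data.Vec as Vec
open import Data.Vec.Properties using (lookup∘tabulate; []=⇒lookup; lookup⇒[]=) renaming (≡-dec to Vec-≡-dec)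
open import Function using (_∘_; id; _⇔_; mk⇔; Equivalence; Inverse; _↔_; mk↔ₛ′)
open import Function.Definitions using (Injective)
open import Function.Properties.Equivalence using () renaming (trans to ⇔-trans; sym to ⇔-sym)
open import Relation.Binary.Definitions using (DecidableEquality; Tri; tri<; tri≈; tri>)
open import Relation.Binary.PropositionalEquality using (_≡_; _≢_; _≗_; refl; sym; trans; cong; cong₂; subst; module ≡-Reasoning)
open import Relation.Nullary using (Dec; yes; no; ¬_; ¬?; contradiction; _×-dec_; _⊎-dec_; _→-dec_)
open import Relation.Nullary.Decidable using (T?; ⌊_⌋; toWitness; fromWitness; decidable-stable)
open import Relation.Unary using (Pred; Decidable)

-- Families of subsets

infix 4 _∈F?_ _∉F_ _⊆F_

_∉F_ : ∀ {n} → Subset n → Fam n → Set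
S ∉F E = ¬ (S ∈F E)

_∈F?_ : ∀ {n} (S : Subset n) (E : Fam n) → Dec (S ∈F E)
_∈F?_ {zero}  []          b       = T? b
_∈F?_ {suc n} (false ∷ S) (l , r) = S ∈F? l
_∈F?_ {suc n} (true ∷ S)  (l , r) = S ∈F? r

∈F-insertF : ∀ {n} (S : Subset n) E → S ∈F insertF S E
∈F-insertF {zero}  []          b       = tt
∈F-insertF {suc n} (false ∷ S) (l , r) = ∈F-insertF S l
∈F-insertF {suc n} (true ∷ S)  (l , r) = ∈F-insertF S r

∈F-insertF⁺ : ∀ {n} {S : Subset n} U {E} → S ∈F E → S ∈F insertF U E
∈F-insertF⁺ {zero}  {[]}        []          p = tt
∈F-insertF⁺ {suc n} {false ∷ S} (false ∷ U) p = ∈F-insertF⁺ U p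
∈F-insertF⁺ {suc n} {false ∷ S} (true ∷ U)  p = p
∈F-insertF⁺ {suc n} {true ∷ S}  (false ∷ U) p = p
∈F-insertF⁺ {suc n} {true ∷ S}  (true ∷ U)  p = ∈F-insertF⁺ U p

∈F-insertF⁻ : ∀ {n} {S : Subset n} U {E} → S ∈F insertF U E → S ≡ U ⊎ S ∈F E
∈F-insertF⁻ {zero}  {[]}        []          p = inj₁ refl
∈F-insertF⁻ {suc n} {false ∷ S} (false ∷ U) p with ∈F-insertF⁻ U p
... | inj₁ refl = inj₁ refl
... | inj₂ q    = inj₂ q
∈F-insertF⁻ {suc n} {false ∷ S} (true ∷ U)  p = inj₂ p
∈F-insertF⁻ {suc n} {true ∷ S}  (false ∷ U) p = inj₂ p
∈F-insertF⁻ {suc n} {true ∷ S}  (true ∷ U)  p with ∈F-insertF⁻ U p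
... | inj₁ refl = inj₁ refl
... | inj₂ q    = inj₂ q

filterF : ∀ {n} {P : Pred (Subset n) 0ℓ} → Decidable P → Fam n
filterF {zero}  P? = ⌊ P? [] ⌋
filterF {suc n} P? = filterF (λ S → P? (false ∷ S)) , filterF (λ S → P? (true ∷ S))

∈F-filterF : ∀ {n} {P : Pred (Subset n) 0ℓ} (P? : Decidable P) S → S ∈F filterF P? ⇔ P S
∈F-filterF {zero}  P? [] = mk⇔ (toWitness {a? = P? []}) (fromWitness {a? = P? []})
∈F-filterF {suc n} P? (false ∷ S) = ∈F-filterF (λ S → P? (false ∷ S)) S
∈F-filterF {suc n} P? (true ∷ S)  = ∈F-filterF (λ S → P? (true ∷ S)) S

_⊆F_ : ∀ {n} → Fam n → Fam n → Set
A ⊆F B = ∀ S → S ∈F A → S ∈F B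

⊆F-antisym : ∀ {n} {A B : Fam n} → A ⊆F B → B ⊆F A → A ≡ B
⊆F-antisym {zero}  {false} {false} f g = refl
⊆F-antisym {zero}  {false} {true}  f g = ⊥-elim (g [] tt)
⊆F-antisym {zero}  {true}  {false} f g = ⊥-elim (f [] tt)
⊆F-antisym {zero}  {true}  {true}  f g = refl
⊆F-antisym {suc n} {l , r} {l' , r'} f g =
  cong₂ _,_ (⊆F-antisym (λ S → f (false ∷ S)) (λ S → g (false ∷ S)))
            (⊆F-antisym (λ S → f (true ∷ S)) (λ S → g (true ∷ S)))

_≟F_ : ∀ {n} → DecidableEquality (Fam n)
_≟F_ {zero} a b = a ≟ᵇ b
_≟F_ {suc n} (l , r) (l' , r') with l ≟F l' | r ≟F r'
... | yes refl | yes refl = yes refl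
... | no l≢l'  | _        = no λ eq → l≢l' (cong proj₁ eq)
... | yes _    | no r≢r'  = no λ eq → r≢r' (cong proj₂ eq)

size : ∀ {n} → Fam n → ℕ
size {zero}  b       = if b then 1 else 0
size {suc n} (l , r) = size l + size r

size≤2^n : ∀ {n} (A : Fam n) → size A ≤ 2 ^ n
size≤2^n {zero}  false   = z≤n
size≤2^n {zero}  true    = s≤s z≤n
size≤2^n {suc n} (l , r) = +-mono-≤ (size≤2^n l) (≤-trans (size≤2^n r) (m≤m+n (2 ^ n) 0))

size-mono : ∀ {n} {A B : Fam n} → A ⊆F B → size A ≤ size B
size-mono {zero}  {false} {b}     f = z≤n
size-mono {zero}  {true}  {true}  f = ≤-refl
size-mono {zero}  {true}  {false} f = ⊥-elim (f [] tt)
size-mono {suc n} {l , r} {l' , r'} f =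
  +-mono-≤ (size-mono (λ S → f (false ∷ S))) (size-mono (λ S → f (true ∷ S)))

+-≤-split : ∀ {a b a' b'} → a ≤ a' → b ≤ b' → a' + b' ≤ a + b → a' ≤ a × b' ≤ b
+-≤-split {a} {b} {a'} {b'} a≤a' b≤b' sum≤ =
  +-cancelʳ-≤ b' a' a (≤-trans sum≤ (+-monoʳ-≤ a b≤b')) ,
  +-cancelˡ-≤ a' b' b (≤-trans sum≤ (+-monoˡ-≤ b a≤a'))

⊆F∧size≤⇒≡ : ∀ {n} {A B : Fam n} → A ⊆F B → size B ≤ size A → A ≡ B
⊆F∧size≤⇒≡ {zero}  {false} {false} f s = refl
⊆F∧size≤⇒≡ {zero}  {true}  {true}  f s = refl
⊆F∧size≤⇒≡ {zero}  {true}  {false} f s = ⊥-elim (f [] tt)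
⊆F∧size≤⇒≡ {suc n} {l , r} {l' , r'} f s =
  let l⊆l' = λ S → f (false ∷ S)
      r⊆r' = λ S → f (true ∷ S)
      l'≤l , r'≤r = +-≤-split (size-mono l⊆l') (size-mono r⊆r') s
  in cong₂ _,_ (⊆F∧size≤⇒≡ l⊆l' l'≤l) (⊆F∧size≤⇒≡ r⊆r' r'≤r)

-- Counting

module _ {A : Set} (_≟_ : DecidableEquality A) where

  open import Data.List.Membership.DecPropositional _≟_ using () renaming (_∈?_ to _∈L?_)

  private
    _without_ : List A → A → List A
    ys without y = filter (λ z → ¬? (y ≟ z)) ys

    length-without< : ∀ {y ys} → y ∈L ys → suc (length (ys without y)) ≤ length ys
    length-without< {y} {ys} y∈ys = filter-notAll (λ z → ¬? (y ≟ z)) ys (Any.map (λ y≡z y≢z → y≢z y≡z) y∈ys)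

  mutual
    length-mono-⊆ : ∀ {xs ys} → Unique xs → (∀ {x} → x ∈L xs → x ∈L ys) → length xs ≤ length ys
    length-mono-⊆ {[]}     _           _  = z≤n
    length-mono-⊆ {x ∷ xs} (x∉ ∷ uxs) xs⊆ys =
      length-mono-⊂ uxs (λ x∈ → xs⊆ys (there x∈)) (xs⊆ys (here refl)) (λ x∈ → All.lookup x∉ x∈ refl)

    length-mono-⊂ : ∀ {xs ys y} → Unique xs → (∀ {x} → x ∈L xs → x ∈L ys) → y ∈L ys → y ∉L xs →
                    length xs < length ys
    length-mono-⊂ {xs} {ys} {y} uxs xs⊆ys y∈ys y∉xs =
      ≤-trans (s≤s (length-mono-⊆ uxs xs⊆ys∖y)) (length-without< y∈ys)
      where
      xs⊆ys∖y : ∀ {x} → x ∈L xs → x ∈L ys without y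
      xs⊆ys∖y {x} x∈xs = ∈-filter⁺ (λ z → ¬? (y ≟ z)) (xs⊆ys x∈xs) λ { refl → y∉xs x∈xs }

  HasCount-<⇔ : ∀ {P Q : A → Set} {m m'} → (∀ {x} → P x → Q x) → HasCount P m → HasCount Q m' →
                m < m' ⇔ ∃ λ x → Q x × ¬ P x
  HasCount-<⇔ {P} {Q} P⊆Q (xs , uxs , refl , ∈xs) (ys , uys , refl , ∈ys) = mk⇔ fresh grows
    where
    open Equivalence
    fresh : length xs < length ys → ∃ λ x → Q x × ¬ P x
    fresh xs<ys with All.all? (_∈L? xs) ys
    ... | yes ys⊆xs = ⊥-elim (≤⇒≯ (length-mono-⊆ uys (All.lookup ys⊆xs)) xs<ys)
    ... | no ys⊈xs with find (¬All⇒Any¬ (_∈L? xs) ys ys⊈xs)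
    ...   | y , y∈ys , y∉xs = y , to (∈ys y) y∈ys , λ Py → y∉xs (from (∈xs y) Py)
    grows : (∃ λ x → Q x × ¬ P x) → length xs < length ys
    grows (y , Qy , ¬Py) =
      length-mono-⊂ uxs (λ {x} x∈ → from (∈ys x) (P⊆Q (to (∈xs x) x∈))) (from (∈ys y) Qy)
                    λ y∈ → ¬Py (to (∈xs y) y∈)

Least : Pred ℕ 0ℓ → Set
Least P = ∃ λ τ → P τ × (∀ i → i < τ → ¬ P i)

least : {P : Pred ℕ 0ℓ} → Decidable P → ∀ j → P j → Least P
least {P} P? = <-rec (λ j → P j → Least P) search
  where
  search : ∀ j → (∀ {i} → i < j → P i → Least P) → P j → Least P
  search j smaller Pj with anyUpTo? P? j
  ... | yes (i , i<j , Pi) = smaller i<j Pi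
  ... | no none            = j , Pj , λ i i<j Pi → none (i , i<j , Pi)

-- The bootstrap process

iterate : {A : Set} → (A → A) → A → ℕ → A
iterate f x zero    = x
iterate f x (suc i) = f (iterate f x i)

module _ {n} (f : Fam n → Fam n) (inflationary : ∀ H → H ⊆F f H) where

  private
    Stationary : Fam n → ℕ → Set
    Stationary H i = iterate f H i ≡ iterate f H (suc i)

  stationary-or-size≥ : ∀ H i → ∃ (Stationary H) ⊎ i ≤ size (iterate f H i)
  stationary-or-size≥ H zero = inj₂ z≤n
  stationary-or-size≥ H (suc i) with stationary-or-size≥ H i | iterate f H i ≟F iterate f H (suc i)
  ... | inj₁ stat | _        = inj₁ stat
  ... | inj₂ _    | yes stat = inj₁ (i , stat)
  ... | inj₂ i≤   | no ¬stat = inj₂ (<-≤-trans (s≤s i≤) grows)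
    where
    grows : size (iterate f H i) < size (iterate f H (suc i))
    grows = ≰⇒> λ ≤size → ¬stat (⊆F∧size≤⇒≡ (inflationary _) ≤size)

  eventually-stationary : ∀ H → ∃ (Stationary H)
  eventually-stationary H with stationary-or-size≥ H (suc (2 ^ n))
  ... | inj₁ stat = stat
  ... | inj₂ >2^n = ⊥-elim (≤⇒≯ (size≤2^n (iterate f H (suc (2 ^ n)))) >2^n)

  runningTime-≥ : ∀ H s → (∀ i → i < s → ¬ Stationary H i) →
                  ∃ λ τ → IsRunningTime (iterate f H) τ × s ≤ τ
  runningTime-≥ H s moving with eventually-stationary H
  ... | j , stat with least (λ i → iterate f H i ≟F iterate f H (suc i)) j stat
  ...   | τ , statτ , ¬stat<τ = τ , (statτ , ¬stat<τ) , ≮⇒≥ λ τ<s → moving τ τ<s statτ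

IsCopy-insertF : ∀ {F n} {H : Fam n} {c} S → IsCopy F H c → IsCopy F (insertF S H) c
IsCopy-insertF S (sub , φ) = (λ S' S'∈ → ∈F-insertF⁺ S (proj₁ (sub S' S'∈)) , proj₂ (sub S' S'∈)) , φ

_≟S_ : ∀ {n} → DecidableEquality (Subset n)
_≟S_ = Vec-≡-dec _≟ᵇ_

_≟SubHG_ : ∀ {n} → DecidableEquality (SubHG n)
_≟SubHG_ = ×-≡-dec _≟S_ _≟F_

module Process (k : ℕ) (F : Hypergraph) {n : ℕ}
               (finite : (H : Fam n) → ∃ (HasCount (IsCopy F H))) where

  NewCopy : Fam n → Subset n → Set
  NewCopy H S = ∃ λ c → IsCopy F (insertF S H) c × ¬ IsCopy F H c

  CountIncreases⇔NewCopy : ∀ {H m m'} S → HasCount (IsCopy F H) m → HasCount (IsCopy F (insertF S H)) m' →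
                           m < m' ⇔ NewCopy H S
  CountIncreases⇔NewCopy S = HasCount-<⇔ _≟SubHG_ (IsCopy-insertF {F} S)

  countIncreases? : ∀ H S → Dec (CountIncreases F H S)
  countIncreases? H S with finite H | finite (insertF S H)
  ... | m , #H | m' , #H∪S with m <? m'
  ...   | yes m<m' = yes (m , m' , #H , #H∪S , m<m')
  ...   | no m≮m'  = no λ (_ , _ , #H₀ , #H∪S₀ , <₀) →
    m≮m' (Equivalence.from (CountIncreases⇔NewCopy S #H #H∪S)
                           (Equivalence.to (CountIncreases⇔NewCopy S #H₀ #H∪S₀) <₀))

  step : Fam n → Fam n
  step H = filterF (λ S → S ∈F? H ⊎-dec (∣ S ∣ ≟ℕ k ×-dec countIncreases? H S))

  step-isStep : ∀ H → Step k F H (step H)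
  step-isStep H = ∈F-filterF _

  process : Fam n → ℕ → Fam n
  process = iterate step

  process-isProcess : ∀ H → IsProcess k F H (process H)
  process-isProcess H = refl , λ i → step-isStep (process H i)

  ∈F-step⁺ : ∀ {H S} → ∣ S ∣ ≡ k → NewCopy H S → S ∈F step H
  ∈F-step⁺ {H} {S} ∣S∣≡k new = Equivalence.from (step-isStep H S)
    (inj₂ (∣S∣≡k , _ , _ , #H , #H∪S , Equivalence.from (CountIncreases⇔NewCopy S #H #H∪S) new))
    where
    #H : HasCount (IsCopy F H) (proj₁ (finite H))
    #H = proj₂ (finite H)
    #H∪S : HasCount (IsCopy F (insertF S H)) (proj₁ (finite (insertF S H)))
    #H∪S = proj₂ (finite (insertF S H))

  ∈F-step⁻ : ∀ {H S} → S ∈F step H → S ∈F H ⊎ (∣ S ∣ ≡ k × NewCopy H S)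
  ∈F-step⁻ {H} {S} S∈ with Equivalence.to (step-isStep H S) S∈
  ... | inj₁ S∈H                               = inj₁ S∈H
  ... | inj₂ (∣S∣≡k , _ , _ , #H , #H∪S , m<m') =
    inj₂ (∣S∣≡k , Equivalence.to (CountIncreases⇔NewCopy S #H #H∪S) m<m')

  ⊆F-step : ∀ H → H ⊆F step H
  ⊆F-step H S S∈H = Equivalence.from (step-isStep H S) (inj₁ S∈H)

  process-mono : ∀ {H i j} → i ≤ j → process H i ⊆F process H j
  process-mono {H} {i} {zero} z≤n = λ S S∈ → S∈
  process-mono {H} {i} {suc j} i≤1+j with m≤n⇒m<n∨m≡n i≤1+j
  ... | inj₁ (s≤s i≤j) = λ S S∈ → ⊆F-step (process H j) S (process-mono i≤j S S∈)
  ... | inj₂ refl      = λ S S∈ → S∈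

  process-moving⇒MAtLeast : ∀ H s → IsKGraph k H → (∀ i → i < s → process H i ≢ process H (suc i)) →
                            MAtLeast k F n s
  process-moving⇒MAtLeast H s isKGraph moving =
    H , isKGraph , process H , process-isProcess H , runningTime-≥ step ⊆F-step H s moving

-- Subsets spanned by lists, and enumerations of functions

∣⁅x⁆∪p∣ : ∀ {n} {x : Fin n} {p} → x ∉ p → ∣ ⁅ x ⁆ ∪ p ∣ ≡ suc ∣ p ∣
∣⁅x⁆∪p∣ {x = zero}  {outside ∷ p} _   = cong suc (cong ∣_∣ (∪-identityˡ p))
∣⁅x⁆∪p∣ {x = zero}  {inside ∷ p}  x∉p = contradiction here x∉p
∣⁅x⁆∪p∣ {x = suc x} {outside ∷ p} x∉p = ∣⁅x⁆∪p∣ (x∉p ∘ there)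
∣⁅x⁆∪p∣ {x = suc x} {inside ∷ p}  x∉p = cong suc (∣⁅x⁆∪p∣ (x∉p ∘ there))

fromList : ∀ {n} → List (Fin n) → Subset n
fromList []       = ∅
fromList (y ∷ ys) = ⁅ y ⁆ ∪ fromList ys

∈-fromList⁺ : ∀ {n} {y : Fin n} {ys} → y ∈L ys → y ∈ fromList ys
∈-fromList⁺ (here refl) = x∈p∪q⁺ (inj₁ (x∈⁅x⁆ _))
∈-fromList⁺ (there y∈)  = x∈p∪q⁺ (inj₂ (∈-fromList⁺ y∈))

∈-fromList⁻ : ∀ {n} {y : Fin n} ys → y ∈ fromList ys → y ∈L ys
∈-fromList⁻ []        y∈ = contradiction y∈ ∉⊥
∈-fromList⁻ (y' ∷ ys) y∈ with x∈p∪q⁻ ⁅ y' ⁆ (fromList ys) y∈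
... | inj₁ y∈⁅y'⁆ = here (x∈⁅y⁆⇒x≡y y' y∈⁅y'⁆)
... | inj₂ y∈ys   = there (∈-fromList⁻ ys y∈ys)

∣fromList∣ : ∀ {n} {ys : List (Fin n)} → Unique ys → ∣ fromList ys ∣ ≡ length ys
∣fromList∣ {n} {ys = []} _           = ∣⊥∣≡0 n
∣fromList∣ {ys = y ∷ ys} (y∉ ∷ uys) = trans (∣⁅x⁆∪p∣ y∉ys) (cong suc (∣fromList∣ uys))
  where
  y∉ys : y ∉ fromList ys
  y∉ys y∈ = All.lookup y∉ (∈-fromList⁻ ys y∈) refl

fromList-swap : ∀ {n} (x y : Fin n) ys → fromList (x ∷ y ∷ ys) ≡ fromList (y ∷ x ∷ ys)
fromList-swap x y ys = begin
  ⁅ x ⁆ ∪ (⁅ y ⁆ ∪ fromList ys)  ≡⟨ sym (∪-assoc ⁅ x ⁆ ⁅ y ⁆ _) ⟩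
  (⁅ x ⁆ ∪ ⁅ y ⁆) ∪ fromList ys  ≡⟨ cong (_∪ fromList ys) (∪-comm ⁅ x ⁆ ⁅ y ⁆) ⟩
  (⁅ y ⁆ ∪ ⁅ x ⁆) ∪ fromList ys  ≡⟨ ∪-assoc ⁅ y ⁆ ⁅ x ⁆ _ ⟩
  ⁅ y ⁆ ∪ (⁅ x ⁆ ∪ fromList ys)  ∎
  where open ≡-Reasoning

vectors : {B : Set} → List B → (m : ℕ) → List (Vec B m)
vectors bs zero    = [] ∷ []
vectors bs (suc m) = cartesianProductWith _∷_ bs (vectors bs m)

∈-vectors : {B : Set} {bs : List B} → (∀ b → b ∈L bs) → ∀ {m} (v : Vec B m) → v ∈L vectors bs m
∈-vectors _∈bs []      = here refl
∈-vectors _∈bs (b ∷ v) = ∈-cartesianProductWith⁺ _∷_ (b ∈bs) (∈-vectors _∈bs v)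

module _ {A B : Set} {as : List A} (_∈as : ∀ x → x ∈L as) where

  fromTable : Vec B (length as) → A → B
  fromTable v x = Vec.lookup v (Any.index (x ∈as))

  toTable : (A → B) → Vec B (length as)
  toTable f = Vec.tabulate (f ∘ List.lookup as)

  fromTable-toTable : ∀ f x → fromTable (toTable f) x ≡ f x
  fromTable-toTable f x =
    trans (lookup∘tabulate (f ∘ List.lookup as) (Any.index (x ∈as))) (cong f (sym (lookup-index (x ∈as))))

  functions : List B → List (A → B)
  functions bs = map fromTable (vectors bs (length as))

  ∈-functions : ∀ {bs} → (∀ b → b ∈L bs) → ∀ f → fromTable (toTable f) ∈L functions bs
  ∈-functions _∈bs f = ∈-map⁺ fromTable (∈-vectors _∈bs (toTable f))

-- Copies of the k-extension of a star

T-lookup⇔∈ : ∀ {n} {S : Subset n} {y} → T (lookup S y) ⇔ y ∈ S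
T-lookup⇔∈ {S = S} {y} =
  mk⇔ (λ p → lookup⇒[]= y S (Equivalence.to T-≡ p)) (λ y∈S → Equivalence.from T-≡ ([]=⇒lookup y∈S))

∈-irrelevant : ∀ {n} {y : Fin n} {S} (p q : y ∈ S) → p ≡ q
∈-irrelevant here      here      = refl
∈-irrelevant (there p) (there q) = cong there (∈-irrelevant p q)

∈-Σ-≡ : ∀ {n} {S : Subset n} {y y'} {p : y ∈ S} {q : y' ∈ S} → y ≡ y' →
        _≡_ {A = Σ (Fin n) (_∈ S)} (y , p) (y' , q)
∈-Σ-≡ {p = p} {q} refl = cong (_ ,_) (∈-irrelevant p q)

module StarCopies (t' k' : ℕ) where

  t k : ℕ
  t = suc (suc t')
  k = suc (suc (suc k'))

  F : Hypergraph
  F = kExtension k (Star t)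

  Leaf : Set
  Leaf = Fin (suc t')

  V : Set
  V = Vtx F

  centre : V
  centre = inj₁ nothing

  leaf : Leaf → V
  leaf a = inj₁ (just a)

  extra : Leaf → Fin (suc k') → V
  extra a s = inj₂ (a , s)

  InEdge : V → Leaf → Set
  InEdge = InExtEdge (Star t) k

  _≟V_ : DecidableEquality V
  _≟V_ = ⊎-≡-dec (Maybe-≡-dec _≟ᶠ_) (×-≡-dec _≟ᶠ_ _≟ᶠ_)

  vertices : List V
  vertices = centre ∷ map leaf (allFin _) ++ cartesianProductWith extra (allFin _) (allFin _)

  _∈vertices : ∀ x → x ∈L vertices
  inj₁ nothing       ∈vertices = here refl
  inj₁ (just a)      ∈vertices = there (∈-++⁺ˡ (∈-map⁺ leaf (∈-allFin a)))
  inj₂ (a , s)       ∈vertices =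
    there (∈-++⁺ʳ (map leaf (allFin _)) (∈-cartesianProductWith⁺ extra (∈-allFin a) (∈-allFin s)))

  edgeVertices : Leaf → List V
  edgeVertices a = centre ∷ leaf a ∷ tabulate (extra a)

  ∈-edgeVertices⁺ : ∀ {x a} → InEdge x a → x ∈L edgeVertices a
  ∈-edgeVertices⁺ {inj₁ nothing}  _           = here refl
  ∈-edgeVertices⁺ {inj₁ (just b)} (inj₂ refl) = there (here refl)
  ∈-edgeVertices⁺ {inj₂ (b , s)}  refl        = there (there (∈-tabulate⁺ {f = extra b} s))

  ∈-edgeVertices⁻ : ∀ {x a} → x ∈L edgeVertices a → InEdge x a
  ∈-edgeVertices⁻ (here refl)         = inj₁ refl
  ∈-edgeVertices⁻ (there (here refl)) = inj₂ refl
  ∈-edgeVertices⁻ {a = a} (there (there x∈)) with ∈-tabulate⁻ {f = extra a} x∈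
  ... | s , refl = refl

  edgeVertices-unique : ∀ a → Unique (edgeVertices a)
  edgeVertices-unique a =
    ((λ ()) ∷ AllP.tabulate⁺ {f = extra a} (λ _ ())) ∷ AllP.tabulate⁺ {f = extra a} (λ _ ()) ∷
    UniqueP.tabulate⁺ {f = extra a} λ { refl → refl }

  module _ {n : ℕ} where

    Embedding : Set
    Embedding = V → Fin n

    edge : Embedding → Leaf → Subset n
    edge ψ a = fromList (map ψ (edgeVertices a))

    vertexSet : Embedding → Subset n
    vertexSet ψ = fromList (map ψ vertices)

    ∈-edge⁺ : ∀ ψ {x a} → InEdge x a → ψ x ∈ edge ψ a
    ∈-edge⁺ ψ x∈a = ∈-fromList⁺ (∈-map⁺ ψ (∈-edgeVertices⁺ x∈a))

    ∈-edge⁻ : ∀ ψ {a y} → y ∈ edge ψ a → ∃ λ x → InEdge x a × y ≡ ψ x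
    ∈-edge⁻ ψ {a} y∈ with ∈-map⁻ ψ (∈-fromList⁻ (map ψ (edgeVertices a)) y∈)
    ... | x , x∈ , y≡ψx = x , ∈-edgeVertices⁻ x∈ , y≡ψx

    ∈-edge-injective : ∀ {ψ} → Injective _≡_ _≡_ ψ → ∀ {x a} → ψ x ∈ edge ψ a → InEdge x a
    ∈-edge-injective {ψ} inj ψx∈ with ∈-edge⁻ ψ ψx∈
    ... | x' , x'∈a , ψx≡ψx' = subst (λ z → InEdge z _) (sym (inj ψx≡ψx')) x'∈a

    ∈-vertexSet : ∀ ψ x → ψ x ∈ vertexSet ψ
    ∈-vertexSet ψ x = ∈-fromList⁺ (∈-map⁺ ψ (x ∈vertices))

    ∈-vertexSet⁻ : ∀ ψ {y} → y ∈ vertexSet ψ → ∃ λ x → y ≡ ψ x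
    ∈-vertexSet⁻ ψ y∈ with ∈-map⁻ ψ (∈-fromList⁻ (map ψ vertices) y∈)
    ... | x , _ , y≡ψx = x , y≡ψx

    ∣edge∣≡k : ∀ {ψ} → Injective _≡_ _≡_ ψ → ∀ a → ∣ edge ψ a ∣ ≡ k
    ∣edge∣≡k {ψ} inj a = begin
      ∣ edge ψ a ∣                          ≡⟨ ∣fromList∣ (UniqueP.map⁺ inj (edgeVertices-unique a)) ⟩
      length (map ψ (edgeVertices a))       ≡⟨ length-map ψ (edgeVertices a) ⟩
      2 + length (tabulate (extra a))       ≡⟨ cong (2 +_) (length-tabulate (extra a)) ⟩
      k                                     ∎
      where open ≡-Reasoning

    ∈-edge⇔ : ∀ {ψ} → Injective _≡_ _≡_ ψ → ∀ {x a} → ψ x ∈ edge ψ a ⇔ InEdge x a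
    ∈-edge⇔ {ψ} inj = mk⇔ (∈-edge-injective inj) (∈-edge⁺ ψ)

    edge-unique : ∀ ψ {S a} → (∀ {y} → y ∈ S → ∃ λ x → y ≡ ψ x) → (∀ x → ψ x ∈ S ⇔ InEdge x a) →
                  S ≡ edge ψ a
    edge-unique ψ {S} {a} S⊆imψ S≈a = ⊆-antisym S⊆edge edge⊆S
      where
      S⊆edge : S ⊆ edge ψ a
      S⊆edge y∈S with S⊆imψ y∈S
      ... | x , refl = ∈-edge⁺ ψ (Equivalence.to (S≈a x) y∈S)
      edge⊆S : edge ψ a ⊆ S
      edge⊆S y∈ with ∈-edge⁻ ψ y∈
      ... | x , x∈a , refl = Equivalence.from (S≈a x) x∈a

    edge⊆vertexSet : ∀ ψ a → edge ψ a ⊆ vertexSet ψ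
    edge⊆vertexSet ψ a y∈ with ∈-edge⁻ ψ y∈
    ... | x , _ , refl = ∈-vertexSet ψ x

    edges : Embedding → Fam n
    edges ψ = filterF (λ S → any? (λ a → S ≟S edge ψ a))

    ∈-edges : ∀ ψ S → S ∈F edges ψ ⇔ ∃ λ a → S ≡ edge ψ a
    ∈-edges ψ = ∈F-filterF (λ S → any? (λ a → S ≟S edge ψ a))

    copyOf : Embedding → SubHG n
    copyOf ψ = vertexSet ψ , edges ψ

    EmbeddingInto : Fam n → Embedding → Set
    EmbeddingInto H ψ = Injective _≡_ _≡_ ψ × ∀ a → edge ψ a ∈F H

    copyOf-isCopy : ∀ {H ψ} → EmbeddingInto H ψ → IsCopy F H (copyOf ψ)
    copyOf-isCopy {H} {ψ} (inj , edge∈H) = edgesIn , φ , edgesMatch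
      where
      edgesIn : ∀ S → S ∈F edges ψ → S ∈F H × S ⊆ vertexSet ψ
      edgesIn S S∈ with Equivalence.to (∈-edges ψ S) S∈
      ... | a , refl = edge∈H a , edge⊆vertexSet ψ a
      preimage : Σ (Fin n) (_∈ vertexSet ψ) → V
      preimage (y , y∈) = proj₁ (∈-vertexSet⁻ ψ y∈)
      φ : V ↔ Σ (Fin n) (_∈ vertexSet ψ)
      φ = mk↔ₛ′ (λ x → ψ x , ∈-vertexSet ψ x) preimage
                (λ (y , y∈) → ∈-Σ-≡ (sym (proj₂ (∈-vertexSet⁻ ψ y∈))))
                (λ x → inj (sym (proj₂ (∈-vertexSet⁻ ψ (∈-vertexSet ψ x)))))
      edgesMatch : ∀ S → S ⊆ vertexSet ψ → S ∈F edges ψ ⇔ IsEdge F (λ x → lookup S (ψ x))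
      edgesMatch S S⊆ = mk⇔ isEdge isEdge⁻¹
        where
        isEdge : S ∈F edges ψ → IsEdge F (λ x → lookup S (ψ x))
        isEdge S∈ with Equivalence.to (∈-edges ψ S) S∈
        ... | a , refl = a , λ x → ⇔-trans T-lookup⇔∈ (∈-edge⇔ inj)
        isEdge⁻¹ : IsEdge F (λ x → lookup S (ψ x)) → S ∈F edges ψ
        isEdge⁻¹ (a , S≈a) = Equivalence.from (∈-edges ψ S)
          (a , edge-unique ψ (∈-vertexSet⁻ ψ ∘ S⊆) (λ x → ⇔-trans (⇔-sym T-lookup⇔∈) (S≈a x)))

    module FromCopy {H : Fam n} {V' : Subset n} {E' : Fam n} (copy : IsCopy F H (V' , E')) where

      φ : V ↔ Σ (Fin n) (_∈ V')
      φ = proj₁ (proj₂ copy)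

      open Inverse φ using (to; from; strictlyInverseˡ; strictlyInverseʳ)

      ψ : Embedding
      ψ x = proj₁ (to x)

      edgesIn : ∀ S → S ∈F E' → S ∈F H × S ⊆ V'
      edgesIn = proj₁ copy

      edgesMatch : ∀ S → S ⊆ V' → S ∈F E' ⇔ IsEdge F (λ x → lookup S (ψ x))
      edgesMatch = proj₂ (proj₂ copy)

      inj : Injective _≡_ _≡_ ψ
      inj {x} {x'} ψx≡ψx' =
        trans (sym (strictlyInverseʳ x)) (trans (cong from (∈-Σ-≡ ψx≡ψx')) (strictlyInverseʳ x'))

      onto : ∀ {y} → y ∈ V' → ∃ λ x → y ≡ ψ x
      onto {y} y∈ = from (y , y∈) , sym (cong proj₁ (strictlyInverseˡ (y , y∈)))

      edge⊆V' : ∀ a → edge ψ a ⊆ V'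
      edge⊆V' a y∈ with ∈-edge⁻ ψ y∈
      ... | x , _ , refl = proj₂ (to x)

      edge∈E' : ∀ a → edge ψ a ∈F E'
      edge∈E' a =
        Equivalence.from (edgesMatch (edge ψ a) (edge⊆V' a)) (a , λ x → ⇔-trans T-lookup⇔∈ (∈-edge⇔ inj))

      edge∈H : ∀ a → edge ψ a ∈F H
      edge∈H a = proj₁ (edgesIn (edge ψ a) (edge∈E' a))

      vertexSet≡V' : vertexSet ψ ≡ V'
      vertexSet≡V' = ⊆-antisym ⊆V' V'⊆
        where
        ⊆V' : vertexSet ψ ⊆ V'
        ⊆V' y∈ with ∈-vertexSet⁻ ψ y∈
        ... | x , refl = proj₂ (to x)
        V'⊆ : V' ⊆ vertexSet ψ
        V'⊆ y∈ with onto y∈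
        ... | x , refl = ∈-vertexSet ψ x

      edges≡E' : edges ψ ≡ E'
      edges≡E' = ⊆F-antisym ⊆E' E'⊆
        where
        ⊆E' : edges ψ ⊆F E'
        ⊆E' S S∈ with Equivalence.to (∈-edges ψ S) S∈
        ... | a , refl = edge∈E' a
        E'⊆ : E' ⊆F edges ψ
        E'⊆ S S∈ with Equivalence.to (edgesMatch S (proj₂ (edgesIn S S∈))) S∈
        ... | a , S≈a = Equivalence.from (∈-edges ψ S)
          (a , edge-unique ψ (onto ∘ proj₂ (edgesIn S S∈)) (λ x → ⇔-trans (⇔-sym T-lookup⇔∈) (S≈a x)))

    isCopy⇒embedding : ∀ {H} c → IsCopy F H c → ∃ λ ψ → EmbeddingInto H ψ × copyOf ψ ≡ c
    isCopy⇒embedding (V' , E') copy = ψ , (inj , edge∈H) , cong₂ _,_ vertexSet≡V' edges≡E'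
      where open FromCopy copy

    injective? : (ψ : Embedding) → Dec (Injective _≡_ _≡_ ψ)
    injective? ψ with All.all? (λ x → All.all? (λ x' → (ψ x ≟ᶠ ψ x') →-dec (x ≟V x')) vertices) vertices
    ... | yes inj = yes λ {x} {x'} → All.lookup (All.lookup inj (x ∈vertices)) (x' ∈vertices)
    ... | no ¬inj = no λ inj → ¬inj (All.tabulate λ _ → All.tabulate λ _ → inj)

    embeddingInto? : ∀ H (ψ : Embedding) → Dec (EmbeddingInto H ψ)
    embeddingInto? H ψ = injective? ψ ×-dec all? (λ a → edge ψ a ∈F? H)

    edge-cong : ∀ {ψ ψ'} → ψ ≗ ψ' → ∀ a → edge ψ a ≡ edge ψ' a
    edge-cong ψ≗ψ' a = cong fromList (map-cong ψ≗ψ' (edgeVertices a))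

    copyOf-cong : ∀ {ψ ψ'} → ψ ≗ ψ' → copyOf ψ ≡ copyOf ψ'
    copyOf-cong {ψ} {ψ'} ψ≗ψ' =
      cong₂ _,_ (cong fromList (map-cong ψ≗ψ' vertices)) (⊆F-antisym (edges⊆ ψ≗ψ') (edges⊆ (sym ∘ ψ≗ψ')))
      where
      edges⊆ : ∀ {ψ ψ'} → ψ ≗ ψ' → edges ψ ⊆F edges ψ'
      edges⊆ {ψ} {ψ'} ψ≗ψ' S S∈ with Equivalence.to (∈-edges ψ S) S∈
      ... | a , refl = Equivalence.from (∈-edges ψ' _) (a , edge-cong ψ≗ψ' a)

    EmbeddingInto-cong : ∀ {H ψ ψ'} → ψ ≗ ψ' → EmbeddingInto H ψ → EmbeddingInto H ψ'
    EmbeddingInto-cong {H} ψ≗ψ' (inj , edge∈H) =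
      (λ {x} {x'} eq → inj (trans (ψ≗ψ' x) (trans eq (sym (ψ≗ψ' x'))))) ,
      (λ a → subst (_∈F H) (edge-cong ψ≗ψ' a) (edge∈H a))

    -- Every copy is the image of an embedding, and embeddings are enumerated through their tables.
    copies : Fam n → List (SubHG n)
    copies H = deduplicate _≟SubHG_ (map copyOf (filter (embeddingInto? H) (functions _∈vertices (allFin n))))

    copies-count : ∀ H → HasCount (IsCopy F H) (length (copies H))
    copies-count H = copies H , deduplicate-! _≟SubHG_ _ , refl , λ c → mk⇔ (sound c) (complete c)
      where
      sound : ∀ c → c ∈L copies H → IsCopy F H c
      sound c c∈ with ∈-map⁻ copyOf (∈-deduplicate⁻ _≟SubHG_ _ c∈)
      ... | ψ , ψ∈ , refl =
        copyOf-isCopy (proj₂ (∈-filter⁻ (embeddingInto? H) {xs = functions _∈vertices (allFin n)} ψ∈))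
      complete : ∀ c → IsCopy F H c → c ∈L copies H
      complete c copy with isCopy⇒embedding c copy
      ... | ψ , embedding , refl = ∈-deduplicate⁺ _≟SubHG_ (subst (_∈L map copyOf _) (copyOf-cong ψ'≗ψ)
            (∈-map⁺ copyOf (∈-filter⁺ (embeddingInto? H) (∈-functions _∈vertices ∈-allFin ψ)
                                                          (EmbeddingInto-cong (sym ∘ ψ'≗ψ) embedding))))
        where
        ψ'≗ψ : fromTable _∈vertices (toTable _∈vertices ψ) ≗ ψ
        ψ'≗ψ = fromTable-toTable _∈vertices ψ

    open Process k F (λ H → length (copies H) , copies-count H) public

    NewCopy⇔ : ∀ {H S} → NewCopy H S ⇔ ∃ λ ψ → EmbeddingInto (insertF S H) ψ × ∃ λ a → edge ψ a ∉F H
    NewCopy⇔ {H} {S} = mk⇔ fromCopy toCopy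
      where
      fromCopy : NewCopy H S → ∃ λ ψ → EmbeddingInto (insertF S H) ψ × ∃ λ a → edge ψ a ∉F H
      fromCopy (c , copy , ¬copy) with isCopy⇒embedding c copy
      ... | ψ , (inj , edge∈) , refl =
        ψ , (inj , edge∈) , ¬∀⟶∃¬ _ _ (λ a → edge ψ a ∈F? H) λ edge∈H → ¬copy (copyOf-isCopy (inj , edge∈H))
      toCopy : (∃ λ ψ → EmbeddingInto (insertF S H) ψ × ∃ λ a → edge ψ a ∉F H) → NewCopy H S
      toCopy (ψ , embedding , a , edge∉H) = copyOf ψ , copyOf-isCopy embedding ,
        λ (edgesIn , _) → edge∉H (proj₁ (edgesIn (edge ψ a) (Equivalence.from (∈-edges ψ _) (a , refl))))

    InEdge-unique : ∀ {x a b} → InEdge x a → InEdge x b → a ≢ b → x ≡ centre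
    InEdge-unique {inj₁ nothing}  _           _           _   = refl
    InEdge-unique {inj₁ (just c)} (inj₁ ())   _           _
    InEdge-unique {inj₁ (just c)} (inj₂ refl) (inj₁ ())   _
    InEdge-unique {inj₁ (just c)} (inj₂ refl) (inj₂ refl) a≢b = ⊥-elim (a≢b refl)
    InEdge-unique {inj₂ (c , s)}  refl        refl        a≢b = ⊥-elim (a≢b refl)

    edges-meet-at-centre : ∀ {ψ} → Injective _≡_ _≡_ ψ → ∀ {a b y} → a ≢ b →
                           y ∈ edge ψ a → y ∈ edge ψ b → y ≡ ψ centre
    edges-meet-at-centre {ψ} inj a≢b y∈a y∈b with ∈-edge⁻ ψ y∈a | ∈-edge⁻ ψ y∈b
    ... | x , x∈a , refl | x' , x'∈b , ψx≡ψx' with inj ψx≡ψx'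
    ...   | refl = cong ψ (InEdge-unique x∈a x'∈b a≢b)

    edge-injective : ∀ {ψ} → Injective _≡_ _≡_ ψ → ∀ {a b} → a ≢ b → edge ψ a ≢ edge ψ b
    edge-injective {ψ} inj {a} a≢b eq
      with ∈-edge-injective inj (subst (ψ (leaf a) ∈_) eq (∈-edge⁺ ψ (inj₂ refl)))
    ... | inj₂ refl = a≢b refl

    Pierces : Embedding → Leaf → ℕ → (ℕ → Fin n) → Set
    Pierces ψ a₀ B W = ∀ b → b ≢ a₀ → ∃ λ ι → ι < B × W ι ∈ edge ψ b × W ι ≢ ψ centre

    ¬Pierces : ∀ {ψ} → Injective _≡_ _≡_ ψ → ∀ a₀ {B} W → B < t' → ¬ Pierces ψ a₀ B W
    ¬Pierces {ψ} inj a₀ {B} W B<t' pierces =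
      let p , q , p<q , same = pigeonhole B<t' (λ p → fromℕ< (ι<B p)) in
      W≢centre p (edges-meet-at-centre inj (punchIn-distinct p<q) (W∈edge p)
                   (subst (λ ι → W ι ∈ edge ψ (punchIn a₀ q))
                          (sym (fromℕ<-injective (ι p) (ι q) (ι<B p) (ι<B q) same)) (W∈edge q)))
      where
      hit : ∀ p → ∃ λ ι → ι < B × W ι ∈ edge ψ (punchIn a₀ p) × W ι ≢ ψ centre
      hit p = pierces (punchIn a₀ p) (punchInᵢ≢i a₀ p)
      ι : Fin t' → ℕ
      ι p = proj₁ (hit p)
      ι<B : ∀ p → ι p < B
      ι<B p = proj₁ (proj₂ (hit p))
      W∈edge : ∀ p → W (ι p) ∈ edge ψ (punchIn a₀ p)
      W∈edge p = proj₁ (proj₂ (proj₂ (hit p)))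
      W≢centre : ∀ p → W (ι p) ≢ ψ centre
      W≢centre p = proj₂ (proj₂ (proj₂ (hit p)))
      punchIn-distinct : ∀ {p q} → p <ᶠ q → punchIn a₀ p ≢ punchIn a₀ q
      punchIn-distinct {p} {q} p<q eq = <-irrefl (cong toℕ (punchIn-injective a₀ p q eq)) p<q

    ∈-edge-cases : ∀ ψ {a y} → y ∈ edge ψ a → y ≡ ψ centre ⊎ y ≡ ψ (leaf a) ⊎ ∃ λ s → y ≡ ψ (extra a s)
    ∈-edge-cases ψ y∈ with ∈-edge⁻ ψ y∈
    ... | inj₁ nothing  , _           , y≡ = inj₁ y≡
    ... | inj₁ (just b) , inj₂ refl   , y≡ = inj₂ (inj₁ y≡)
    ... | inj₂ (b , s)  , refl        , y≡ = inj₂ (inj₂ (s , y≡))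

    edge-cong-local : ∀ {ψ ψ' a} → (∀ x → InEdge x a → ψ x ≡ ψ' x) → edge ψ a ≡ edge ψ' a
    edge-cong-local agree = cong fromList (map-cong-local (All.tabulate λ x∈ → agree _ (∈-edgeVertices⁻ x∈)))

    edge-swap : ∀ {ψ ψ' a} → ψ' centre ≡ ψ (leaf a) → ψ' (leaf a) ≡ ψ centre →
                (∀ s → ψ' (extra a s) ≡ ψ (extra a s)) → edge ψ' a ≡ edge ψ a
    edge-swap {ψ} {ψ'} {a} centre↦leaf leaf↦centre same = begin
      edge ψ' a
        ≡⟨ cong fromList (cong₂ _∷_ centre↦leaf (cong₂ _∷_ leaf↦centre extras)) ⟩
      fromList (ψ (leaf a) ∷ ψ centre ∷ map ψ (tabulate (extra a)))
        ≡⟨ fromList-swap (ψ (leaf a)) (ψ centre) (map ψ (tabulate (extra a))) ⟩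
      edge ψ a ∎
      where
      open ≡-Reasoning
      extras : map ψ' (tabulate (extra a)) ≡ map ψ (tabulate (extra a))
      extras = map-cong-local (AllP.tabulate⁺ same)

-- The construction

byCmp : {A : Set} → ℕ → ℕ → A → A → A → A
byCmp p q below at above with ℕ.<-cmp p q
... | tri< _ _ _ = below
... | tri≈ _ _ _ = at
... | tri> _ _ _ = above

byCmp-< : ∀ {A : Set} {p q} {below at above : A} → p < q → byCmp p q below at above ≡ below
byCmp-< {p = p} {q} p<q with ℕ.<-cmp p q
... | tri< _ _ _    = refl
... | tri≈ _ p≡q _  = ⊥-elim (<-irrefl p≡q p<q)
... | tri> _ _ q<p  = ⊥-elim (<-asym p<q q<p)

byCmp-≡ : ∀ {A : Set} {p q} {below at above : A} → p ≡ q → byCmp p q below at above ≡ at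
byCmp-≡ {p = p} {q} p≡q with ℕ.<-cmp p q
... | tri< p<q _ _ = ⊥-elim (<-irrefl p≡q p<q)
... | tri≈ _ _ _   = refl
... | tri> _ _ q<p = ⊥-elim (<-irrefl (sym p≡q) q<p)

byCmp-> : ∀ {A : Set} {p q} {below at above : A} → q < p → byCmp p q below at above ≡ above
byCmp-> {p = p} {q} q<p with ℕ.<-cmp p q
... | tri< p<q _ _  = ⊥-elim (<-asym p<q q<p)
... | tri≈ _ p≡q _  = ⊥-elim (<-irrefl (sym p≡q) q<p)
... | tri> _ _ _    = refl

saturate : ∀ {m} → ℕ → Fin (suc m)
saturate {m}     zero    = zero
saturate {zero}  (suc r) = zero
saturate {suc m} (suc r) = suc (saturate r)

saturate-toℕ : ∀ {m} (c : Fin (suc m)) → saturate (toℕ c) ≡ c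
saturate-toℕ zero              = refl
saturate-toℕ {suc m} (suc c)   = cong suc (saturate-toℕ c)

module Labels (t' k' : ℕ) where
  open StarCopies t' k'

  -- core c is the c-th core vertex; pendant j a s and link a b s are the private vertices of
  -- P(j, a) and of L(a, b).
  data Label : Set where
    core    : Fin t → Label
    pendant : Leaf → Leaf → Fin (suc (suc k')) → Label
    link    : Leaf → Fin t → Fin (suc k') → Label

  #pendant #link N : ℕ
  #pendant = suc t' * suc t' * suc (suc k')
  #link    = suc t' * t * suc k'
  N        = t + (#pendant + #link)

  encode : Label → Fin N
  encode (core c)        = c ↑ˡ (#pendant + #link)
  encode (pendant j a s) = t ↑ʳ (combine (combine j a) s ↑ˡ #link)
  encode (link a b s)    = t ↑ʳ (#pendant ↑ʳ combine (combine a b) s)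

  pendantOf : Fin (suc t' * suc t') → Fin (suc (suc k')) → Label
  pendantOf ja s = uncurry (λ j a → pendant j a s) (remQuot (suc t') ja)

  linkOf : Fin (suc t' * t) → Fin (suc k') → Label
  linkOf ab s = uncurry (λ a b → link a b s) (remQuot t ab)

  decodePendant : Fin #pendant → Label
  decodePendant = uncurry pendantOf ∘ remQuot (suc (suc k'))

  decodeLink : Fin #link → Label
  decodeLink = uncurry linkOf ∘ remQuot (suc k')

  decodeNonCore : Fin (#pendant + #link) → Label
  decodeNonCore = [ decodePendant , decodeLink ] ∘ splitAt #pendant

  decode : Fin N → Label
  decode = [ core , decodeNonCore ] ∘ splitAt t

  decode-encode : ∀ l → decode (encode l) ≡ l
  decode-encode (core c) = cong [ core , decodeNonCore ] (splitAt-↑ˡ t c (#pendant + #link))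
  decode-encode (pendant j a s) = begin
    decode (encode (pendant j a s))
      ≡⟨ cong [ core , decodeNonCore ] (splitAt-↑ʳ t (#pendant + #link) _) ⟩
    decodeNonCore (combine (combine j a) s ↑ˡ #link)
      ≡⟨ cong [ decodePendant , decodeLink ] (splitAt-↑ˡ #pendant (combine (combine j a) s) #link) ⟩
    decodePendant (combine (combine j a) s)
      ≡⟨ cong (uncurry pendantOf) (remQuot-combine (combine j a) s) ⟩
    pendantOf (combine j a) s
      ≡⟨ cong (uncurry (λ j a → pendant j a s)) (remQuot-combine j a) ⟩
    pendant j a s ∎
    where open ≡-Reasoning
  decode-encode (link a b s) = begin
    decode (encode (link a b s))
      ≡⟨ cong [ core , decodeNonCore ] (splitAt-↑ʳ t (#pendant + #link) _) ⟩
    decodeNonCore (#pendant ↑ʳ combine (combine a b) s)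
      ≡⟨ cong [ decodePendant , decodeLink ] (splitAt-↑ʳ #pendant #link (combine (combine a b) s)) ⟩
    decodeLink (combine (combine a b) s)
      ≡⟨ cong (uncurry linkOf) (remQuot-combine (combine a b) s) ⟩
    linkOf (combine a b) s
      ≡⟨ cong (uncurry (λ a b → link a b s)) (remQuot-combine a b) ⟩
    link a b s ∎
    where open ≡-Reasoning

  -- The copy centred at core j: leaf a < j spans L(a, j), leaf j spans L(j, m), leaf a > j spans P(j, a).
  embed : Leaf → Fin t → V → Label
  embed j m (inj₁ nothing)  = core (inject₁ j)
  embed j m (inj₁ (just a)) = byCmp (toℕ a) (toℕ j) (core (inject₁ a)) (core m) (pendant j a zero)
  embed j m (inj₂ (a , s))  = byCmp (toℕ a) (toℕ j) (link a (inject₁ j) s) (link a m s) (pendant j a (suc s))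

  unembed : Leaf → Label → V
  unembed j (core c)               = byCmp (toℕ c) (toℕ j) (leaf (saturate (toℕ c))) centre (leaf j)
  unembed j (pendant _ a zero)     = leaf a
  unembed j (pendant _ a (suc s))  = extra a s
  unembed j (link a _ s)           = extra a s

  unembed-embed : ∀ {j m} → toℕ j < toℕ m → ∀ x → unembed j (embed j m x) ≡ x
  unembed-embed {j} j<m (inj₁ nothing) = byCmp-≡ (toℕ-inject₁ j)
  unembed-embed {j} {m} j<m (inj₁ (just a)) with ℕ.<-cmp (toℕ a) (toℕ j)
  ... | tri< a<j _ _ = trans (byCmp-< (subst (_< toℕ j) (sym (toℕ-inject₁ a)) a<j))
                             (cong leaf (trans (cong saturate (toℕ-inject₁ a)) (saturate-toℕ a)))
  ... | tri≈ _ a≡j _ = trans (byCmp-> j<m) (cong leaf (toℕ-injective (sym a≡j)))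
  ... | tri> _ _ _   = refl
  unembed-embed {j} j<m (inj₂ (a , s)) with ℕ.<-cmp (toℕ a) (toℕ j)
  ... | tri< _ _ _ = refl
  ... | tri≈ _ _ _ = refl
  ... | tri> _ _ _ = refl

module Construction (t' k' : ℕ) {n : ℕ} (N≤n : Labels.N t' k' ≤ n) where
  open StarCopies t' k'
  open Labels t' k'

  vertex : Label → Fin n
  vertex l = inject≤ (encode l) N≤n

  vertex-injective : Injective _≡_ _≡_ vertex
  vertex-injective {l} {l'} eq =
    trans (sym (decode-encode l)) (trans (cong decode (inject≤-injective N≤n N≤n _ _ eq)) (decode-encode l'))

  embedding : Leaf → Fin t → Embedding
  embedding j m = vertex ∘ embed j m

  embedding-injective : ∀ {j m} → toℕ j < toℕ m → Injective _≡_ _≡_ (embedding j m)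
  embedding-injective {j} {m} j<m {x} {y} eq =
    trans (sym (unembed-embed j<m x))
          (trans (cong (unembed j) (vertex-injective {embed j m x} {embed j m y} eq)) (unembed-embed j<m y))

  last : Fin t
  last = fromℕ (suc t')

  j<last : ∀ (j : Leaf) → toℕ j < toℕ last
  j<last j = subst (toℕ j <_) (sym (toℕ-fromℕ (suc t'))) (toℕ<n j)

  pendantEdge : Leaf → Leaf → Subset n
  pendantEdge j a = edge (embedding j last) a

  linkEdge : Leaf → Subset n
  linkEdge j = edge (embedding j last) j

  initial : Fam n
  initial = filterF λ S → any? λ j → any? λ a → toℕ j <? toℕ a ×-dec S ≟S pendantEdge j a

  ∈-initial : ∀ S → S ∈F initial ⇔ ∃₂ λ j a → toℕ j < toℕ a × S ≡ pendantEdge j a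
  ∈-initial = ∈F-filterF _

  pendantEdge∈initial : ∀ {j a} → toℕ j < toℕ a → pendantEdge j a ∈F initial
  pendantEdge∈initial {j} {a} j<a = Equivalence.from (∈-initial _) (j , a , j<a , refl)

  initial-isKGraph : IsKGraph k initial
  initial-isKGraph S S∈ with Equivalence.to (∈-initial S) S∈
  ... | j , a , _ , refl = ∣edge∣≡k (embedding-injective (j<last j)) a

  edge-embedding-pendant : ∀ {j a} m → toℕ j < toℕ a → edge (embedding j m) a ≡ pendantEdge j a
  edge-embedding-pendant {j} {a} m j<a = edge-cong-local agree
    where
    agree : ∀ x → InEdge x a → embedding j m x ≡ embedding j last x
    agree (inj₁ nothing)  _           = refl
    agree (inj₁ (just b)) (inj₂ refl) = cong vertex (trans (byCmp-> j<a) (sym (byCmp-> j<a)))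
    agree (inj₂ (b , s))  refl        = cong vertex (trans (byCmp-> j<a) (sym (byCmp-> j<a)))

  edge-embedding-link : ∀ {j a} m → toℕ a < toℕ j → edge (embedding j m) a ≡ edge (embedding a (inject₁ j)) a
  edge-embedding-link {j} {a} m a<j = edge-swap
    (cong vertex (sym (byCmp-≡ {p = toℕ a} refl)))
    (cong vertex (byCmp-< a<j))
    (λ s → cong vertex (trans (byCmp-< a<j) (sym (byCmp-≡ {p = toℕ a} refl))))

  edge∈process : ∀ d {j m} → toℕ j < d → toℕ j < toℕ m → edge (embedding j m) j ∈F process initial (suc (toℕ j))
  edge∈process (suc d) {j} {m} (s≤s j≤d) j<m = extend (edge ψ j ∈F? H)
    where
    ψ : Embedding
    ψ = embedding j m
    H : Fam n
    H = process initial (toℕ j)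
    inj : Injective _≡_ _≡_ ψ
    inj = embedding-injective j<m
    edge∈ : ∀ a → Tri (toℕ a < toℕ j) (toℕ a ≡ toℕ j) (toℕ j < toℕ a) → edge ψ a ∈F insertF (edge ψ j) H
    edge∈ a (tri< a<j _ _) = ∈F-insertF⁺ (edge ψ j) (process-mono {H = initial} a<j (edge ψ a)
      (subst (_∈F process initial (suc (toℕ a))) (sym (edge-embedding-link m a<j))
             (edge∈process d (≤-trans a<j j≤d) (subst (toℕ a <_) (sym (toℕ-inject₁ j)) a<j))))
    edge∈ a (tri≈ _ a≡j _) =
      subst (λ b → edge ψ b ∈F insertF (edge ψ j) H) (toℕ-injective (sym a≡j)) (∈F-insertF (edge ψ j) H)
    edge∈ a (tri> _ _ j<a) = ∈F-insertF⁺ (edge ψ j) (process-mono {H = initial} {j = toℕ j} z≤n (edge ψ a)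
      (subst (_∈F initial) (sym (edge-embedding-pendant m j<a)) (pendantEdge∈initial j<a)))
    extend : Dec (edge ψ j ∈F H) → edge ψ j ∈F step H
    extend (yes old) = ⊆F-step H (edge ψ j) old
    extend (no new)  = ∈F-step⁺ {H = H} {S = edge ψ j} (∣edge∣≡k inj j)
      (Equivalence.from NewCopy⇔ (ψ , (inj , λ a → edge∈ a (ℕ.<-cmp (toℕ a) (toℕ j))) , j , new))

  linkEdge∈process : ∀ j → linkEdge j ∈F process initial (suc (toℕ j))
  linkEdge∈process j = edge∈process (suc (toℕ j)) ≤-refl (j<last j)

  Anchored : ℕ → Subset n → Set
  Anchored i S = S ∈F initial ⊎ ∃ λ c → toℕ c < i × vertex (core c) ∈ S

  anchored? : ∀ i S → Dec (Anchored i S)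
  anchored? i S = S ∈F? initial ⊎-dec any? λ c → toℕ c <? i ×-dec vertex (core c) ∈? S

  Anchored-suc : ∀ {i S} → Anchored i S → Anchored (suc i) S
  Anchored-suc (inj₁ S∈)                = inj₁ S∈
  Anchored-suc (inj₂ (c , c<i , c∈S)) = inj₂ (c , ℕ.m<n⇒m<1+n c<i , c∈S)

  ∈-pendantEdge⁻ : ∀ {j a y} → toℕ j < toℕ a → y ∈ pendantEdge j a →
                   y ≡ vertex (core (inject₁ j)) ⊎ ∃ λ s → y ≡ vertex (pendant j a s)
  ∈-pendantEdge⁻ {j} j<a y∈ with ∈-edge-cases (embedding j last) y∈
  ... | inj₁ y≡               = inj₁ y≡
  ... | inj₂ (inj₁ y≡)        = inj₂ (zero , trans y≡ (cong vertex (byCmp-> j<a)))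
  ... | inj₂ (inj₂ (s , y≡)) = inj₂ (suc s , trans y≡ (cong vertex (byCmp-> j<a)))

  pendant∈pendantEdge : ∀ {j a} → toℕ j < toℕ a → ∀ s → vertex (pendant j a s) ∈ pendantEdge j a
  pendant∈pendantEdge {j} {a} j<a zero =
    subst (_∈ pendantEdge j a) (cong vertex (byCmp-> j<a)) (∈-edge⁺ (embedding j last) {leaf a} (inj₂ refl))
  pendant∈pendantEdge {j} {a} j<a (suc s) =
    subst (_∈ pendantEdge j a) (cong vertex (byCmp-> j<a)) (∈-edge⁺ (embedding j last) {extra a s} refl)

  ∈-linkEdge⁻ : ∀ {j y} → y ∈ linkEdge j →
                y ≡ vertex (core (inject₁ j)) ⊎ y ≡ vertex (core last) ⊎ ∃ λ s → y ≡ vertex (link j last s)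
  ∈-linkEdge⁻ {j} y∈ with ∈-edge-cases (embedding j last) y∈
  ... | inj₁ y≡               = inj₁ y≡
  ... | inj₂ (inj₁ y≡)        = inj₂ (inj₁ (trans y≡ (cong vertex (byCmp-≡ {p = toℕ j} refl))))
  ... | inj₂ (inj₂ (s , y≡)) = inj₂ (inj₂ (s , trans y≡ (cong vertex (byCmp-≡ {p = toℕ j} refl))))

  link∈linkEdge : ∀ j → vertex (link j last zero) ∈ linkEdge j
  link∈linkEdge j =
    subst (_∈ linkEdge j) (cong vertex (byCmp-≡ {p = toℕ j} refl))
          (∈-edge⁺ (embedding j last) {extra j zero} refl)

  linkEdge-¬Anchored : ∀ j → ¬ Anchored (toℕ j) (linkEdge j)
  linkEdge-¬Anchored j (inj₁ S∈) with Equivalence.to (∈-initial _) S∈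
  ... | j' , a' , j'<a' , linkEdge≡ with ∈-pendantEdge⁻ j'<a' (subst (_ ∈_) linkEdge≡ (link∈linkEdge j))
  ...   | inj₁ e       with () ← vertex-injective {link j last zero} {core (inject₁ j')} e
  ...   | inj₂ (s , e) with () ← vertex-injective {link j last zero} {pendant j' a' s} e
  linkEdge-¬Anchored j (inj₂ (c , c<j , c∈)) with ∈-linkEdge⁻ c∈
  ... | inj₁ e with refl ← vertex-injective {core c} {core (inject₁ j)} e = <-irrefl (toℕ-inject₁ j) c<j
  ... | inj₂ (inj₁ e) with refl ← vertex-injective {core c} {core last} e = ℕ.<-asym c<j (j<last j)
  ... | inj₂ (inj₂ (s , e)) with () ← vertex-injective {core c} {link j last s} e

  pendant∉linkEdge : ∀ j j' a' s → vertex (pendant j' a' s) ∉ linkEdge j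
  pendant∉linkEdge j j' a' s p∈ with ∈-linkEdge⁻ p∈
  ... | inj₁ e                with () ← vertex-injective {pendant j' a' s} {core (inject₁ j)} e
  ... | inj₂ (inj₁ e)         with () ← vertex-injective {pendant j' a' s} {core last} e
  ... | inj₂ (inj₂ (s' , e)) with () ← vertex-injective {pendant j' a' s} {link j last s'} e

  core-injective : ∀ {c c'} → core c ≡ core c' → c ≡ c'
  core-injective refl = refl

  pendant-injective₃ : ∀ {j a s j' a' s'} → pendant j a s ≡ pendant j' a' s' → s ≡ s'
  pendant-injective₃ refl = refl

  core≢pendant : ∀ c j a s → vertex (core c) ≢ vertex (pendant j a s)
  core≢pendant c j a s eq with () ← vertex-injective {core c} {pendant j a s} eq

  -- As k ≥ 3, every pendant edge has a second private vertex; it pierces P(j, a) when the centre is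
  -- the first one.
  other : Fin (suc (suc k')) → Fin (suc (suc k'))
  other zero    = suc zero
  other (suc _) = zero

  other-≢ : ∀ s → other s ≢ s
  other-≢ zero    ()
  other-≢ (suc _) ()

  private
    pred<self : ∀ {x y} → y < x → pred x < x
    pred<self {suc x} _ = ≤-refl

    ∸2<pred : ∀ {x y} → 2 ≤ x → x ≤ y → x ∸ 2 < pred y
    ∸2<pred (s≤s (s≤s _)) (s≤s (s≤s x≤y)) = s≤s x≤y

    ≤∸2 : ∀ {i x} → 2 + i ≤ x → i ≤ x ∸ 2
    ≤∸2 (s≤s (s≤s i≤x)) = i≤x

  coresThen : ℕ → (ℕ → Fin n) → ℕ → Fin n
  coresThen i R ι with ι <? i
  ... | yes _ = vertex (core (saturate ι))
  ... | no _  = R ι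

  coresThen-< : ∀ {i ι} R → ι < i → coresThen i R ι ≡ vertex (core (saturate ι))
  coresThen-< {i} {ι} R ι<i with ι <? i
  ... | yes _  = refl
  ... | no ι≮i = ⊥-elim (ι≮i ι<i)

  coresThen-≥ : ∀ {i ι} R → i ≤ ι → coresThen i R ι ≡ R ι
  coresThen-≥ {i} {ι} R i≤ι with ι <? i
  ... | yes ι<i = ⊥-elim (ℕ.≤⇒≯ i≤ι ι<i)
  ... | no _    = refl

  module NewEdge {i : ℕ} (i+3≤t : 3 + i ≤ t)
                 (anchored : ∀ S → S ∈F process initial i → Anchored i S)
                 {e : Subset n} (e-¬anchored : ¬ Anchored (suc i) e)
                 {ψ : Embedding} (inj : Injective _≡_ _≡_ ψ)
                 (edge∈ : ∀ a → edge ψ a ∈F insertF e (process initial i))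
                 {a₀ : Leaf} (edge∉ : edge ψ a₀ ∉F process initial i) where

    c : Fin n
    c = ψ centre

    c∈edge : ∀ b → c ∈ edge ψ b
    c∈edge b = ∈-edge⁺ ψ {centre} (inj₁ refl)

    edge-a₀≡e : edge ψ a₀ ≡ e
    edge-a₀≡e = [ id , (λ old → ⊥-elim (edge∉ old)) ] (∈F-insertF⁻ e (edge∈ a₀))

    c∈e : c ∈ e
    c∈e = subst (c ∈_) edge-a₀≡e (c∈edge a₀)

    i<core : ∀ {m} → c ≡ vertex (core m) → i < toℕ m
    i<core {m} c≡ = ≮⇒≥ λ m<1+i → e-¬anchored (inj₂ (m , m<1+i , subst (_∈ e) c≡ c∈e))

    others-anchored : ∀ b → b ≢ a₀ → Anchored i (edge ψ b)
    others-anchored b b≢a₀ =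
      [ (λ eq → ⊥-elim (edge-injective inj b≢a₀ (trans eq (sym edge-a₀≡e)))) , anchored (edge ψ b) ]
      (∈F-insertF⁻ e (edge∈ b))

    i<t' : i < t'
    i<t' = s≤s⁻¹ (s≤s⁻¹ i+3≤t)

    B : ℕ
    B = pred t'

    Hit : (ℕ → Fin n) → Leaf → Set
    Hit R b = ∃ λ ι → ι < B × coresThen i R ι ∈ edge ψ b × coresThen i R ι ≢ c

    hit-anchored : ∀ R b → b ≢ a₀ → (∀ {j a} → toℕ j < toℕ a → edge ψ b ≡ pendantEdge j a → Hit R b) → Hit R b
    hit-anchored R b b≢a₀ hit-initial = [ hit-initial′ , hit-core ] (others-anchored b b≢a₀)
      where
      hit-initial′ : edge ψ b ∈F initial → Hit R b
      hit-initial′ b∈ = let _ , _ , j<a , eq = Equivalence.to (∈-initial _) b∈ in hit-initial j<a eq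
      hit-core : (∃ λ m → toℕ m < i × vertex (core m) ∈ edge ψ b) → Hit R b
      hit-core (m , m<i , m∈) =
        toℕ m , <-≤-trans m<i (ℕ.<⇒≤pred i<t') , subst (_∈ edge ψ b) (sym core-m) m∈ ,
        λ core-m≡c → ℕ.<-asym m<i (i<core (trans (sym core-m≡c) core-m))
        where
        core-m : coresThen i R (toℕ m) ≡ vertex (core m)
        core-m = trans (coresThen-< R m<i) (cong (vertex ∘ core) (saturate-toℕ m))

    HitsInitial : (ℕ → Fin n) → Set
    HitsInitial R = ∀ {b j a} → toℕ j < toℕ a → edge ψ b ≡ pendantEdge j a → Hit R b

    ¬HitsInitial : ∀ R → ¬ HitsInitial R
    ¬HitsInitial R hit-initial =
      ¬Pierces inj a₀ (coresThen i R) (pred<self i<t') λ b b≢a₀ → hit-anchored R b b≢a₀ hit-initial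

    c∈pendantEdge : ∀ {b j a} → toℕ j < toℕ a → edge ψ b ≡ pendantEdge j a →
                    c ≡ vertex (core (inject₁ j)) ⊎ ∃ λ s → c ≡ vertex (pendant j a s)
    c∈pendantEdge {b} j<a eq = ∈-pendantEdge⁻ j<a (subst (c ∈_) eq (c∈edge b))

    centre-core : ∀ m → c ≡ vertex (core m) → ⊥
    centre-core m c≡m = ¬HitsInitial R hit-initial
      where
      -- P(m, a) with a > m > i is pierced by its first private vertex, placed at index a − 2 ∈ [i, t' − 1).
      R : ℕ → Fin n
      R ι = vertex (pendant (saturate (toℕ m)) (saturate (2 + ι)) zero)
      hit-initial : HitsInitial R
      hit-initial {b} {j} {a} j<a eq =
        [ at-core , (λ (s , c≡) → ⊥-elim (core≢pendant m j a s (trans (sym c≡m) c≡))) ] (c∈pendantEdge j<a eq)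
        where
        at-core : c ≡ vertex (core (inject₁ j)) → Hit R b
        at-core c≡ = toℕ a ∸ 2 , ∸2<pred 2≤a (s≤s⁻¹ (toℕ<n a)) , subst (_∈ edge ψ b) (sym R≡) pendant∈ ,
                     λ R≡c → core≢pendant m j a zero (sym (trans (sym R≡) (trans R≡c c≡m)))
          where
          m≡j : toℕ m ≡ toℕ j
          m≡j = trans (cong toℕ (core-injective
                         (vertex-injective {core m} {core (inject₁ j)} (trans (sym c≡m) c≡))))
                      (toℕ-inject₁ j)
          2+i≤a : 2 + i ≤ toℕ a
          2+i≤a = <-≤-trans (s≤s (subst (i <_) m≡j (i<core c≡m))) j<a
          2≤a : 2 ≤ toℕ a
          2≤a = ≤-trans (s≤s (s≤s z≤n)) 2+i≤a
          R≡ : coresThen i R (toℕ a ∸ 2) ≡ vertex (pendant j a zero)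
          R≡ = trans (coresThen-≥ R (≤∸2 2+i≤a))
                     (cong₂ (λ j' a' → vertex (pendant j' a' zero))
                            (trans (cong saturate m≡j) (saturate-toℕ j))
                            (trans (cong saturate (ℕ.m+[n∸m]≡n 2≤a)) (saturate-toℕ a)))
          pendant∈ : vertex (pendant j a zero) ∈ edge ψ b
          pendant∈ = subst (_ ∈_) (sym eq) (pendant∈pendantEdge j<a zero)

    centre-pendant : ∀ j a s → c ≡ vertex (pendant j a s) → 4 + i ≤ t → ⊥
    centre-pendant j a s c≡p i+4≤t = ¬HitsInitial R hit-initial
      where
      R : ℕ → Fin n
      R _ = vertex (pendant j a (other s))
      R≡ : coresThen i R i ≡ vertex (pendant j a (other s))
      R≡ = coresThen-≥ R (≤-refl {i})
      at-pendant : ∀ {b j' a' s'} → toℕ j' < toℕ a' → edge ψ b ≡ pendantEdge j' a' →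
                   pendant j a s ≡ pendant j' a' s' → Hit R b
      at-pendant {b} j<a eq refl =
        i , ℕ.<⇒≤pred (s≤s⁻¹ (s≤s⁻¹ i+4≤t)) ,
        subst (_∈ edge ψ b) (sym R≡) (subst (_ ∈_) (sym eq) (pendant∈pendantEdge j<a (other s))) ,
        λ R≡c → other-≢ s (pendant-injective₃
                  (vertex-injective {pendant j a (other s)} {pendant j a s} (trans (sym R≡) (trans R≡c c≡p))))
      hit-initial : HitsInitial R
      hit-initial {b} {j'} {a'} j'<a' eq =
        [ (λ c≡ → ⊥-elim (core≢pendant (inject₁ j') j a s (sym (trans (sym c≡p) c≡)))) ,
          (λ (s' , c≡) → at-pendant j'<a' eq
                           (vertex-injective {pendant j a s} {pendant j' a' s'} (trans (sym c≡p) c≡))) ]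
        (c∈pendantEdge j'<a' eq)

    centre-elsewhere : (∀ m → c ≢ vertex (core m)) → (∀ j a s → c ≢ vertex (pendant j a s)) → ⊥
    centre-elsewhere ¬core ¬pendant = ¬HitsInitial (λ _ → c) λ {_} {j} {a} j<a eq →
      [ (λ c≡ → ⊥-elim (¬core (inject₁ j) c≡)) , (λ (s , c≡) → ⊥-elim (¬pendant j a s c≡)) ]
      (c∈pendantEdge j<a eq)

    impossible : 4 + i ≤ t ⊎ (∀ j a s → vertex (pendant j a s) ∉ e) → ⊥
    impossible room = by-core (any? λ m → c ≟ᶠ vertex (core m))
      where
      by-pendant : (∀ m → c ≢ vertex (core m)) → Dec (∃ λ j → ∃ λ a → ∃ λ s → c ≡ vertex (pendant j a s)) → ⊥
      by-pendant ¬core (no ¬pendant) = centre-elsewhere ¬core λ j a s c≡ → ¬pendant (j , a , s , c≡)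
      by-pendant ¬core (yes (j , a , s , c≡)) =
        [ centre-pendant j a s c≡ , (λ no-pendant → no-pendant j a s (subst (_∈ e) c≡ c∈e)) ] room
      by-core : Dec (∃ λ m → c ≡ vertex (core m)) → ⊥
      by-core (yes (m , c≡)) = centre-core m c≡
      by-core (no ¬core)     = by-pendant (λ m c≡ → ¬core (m , c≡))
                                          (any? λ j → any? λ a → any? λ s → c ≟ᶠ vertex (pendant j a s))

  -- The second alternative covers the last step, where i + 4 ≤ t fails but the new edge L(j, last)
  -- has no pendant vertex.
  step-preserves-Anchored : ∀ {i} → 3 + i ≤ t → (∀ S → S ∈F process initial i → Anchored i S) →
                            ∀ {e} → e ∈F process initial (suc i) →
                            4 + i ≤ t ⊎ (∀ j a s → vertex (pendant j a s) ∉ e) → Anchored (suc i) e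
  step-preserves-Anchored {i} i+3≤t anchored {e} e∈ room = [ Anchored-suc ∘ anchored e , by-new ] (∈F-step⁻ e∈)
    where
    by-new : ∣ e ∣ ≡ k × NewCopy (process initial i) e → Anchored (suc i) e
    by-new (_ , new) = decidable-stable (anchored? (suc i) e) λ e-¬anchored →
      let ψ , (inj , edge∈) , a₀ , edge∉ = Equivalence.to NewCopy⇔ new
      in NewEdge.impossible {i} i+3≤t anchored {e} e-¬anchored {ψ} inj edge∈ {a₀} edge∉ room

  process⊆Anchored : ∀ i → 3 + i ≤ t → ∀ S → S ∈F process initial i → Anchored i S
  process⊆Anchored zero    _      S S∈ = inj₁ S∈
  process⊆Anchored (suc i) i+4≤t S S∈ =
    step-preserves-Anchored i+3≤t (process⊆Anchored i i+3≤t) S∈ (inj₁ i+4≤t)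
    where
    i+3≤t : 3 + i ≤ t
    i+3≤t = ≤-trans (n≤1+n _) i+4≤t

  linkEdge∉process : ∀ j → linkEdge j ∉F process initial (toℕ j)
  linkEdge∉process zero    ∈initial = linkEdge-¬Anchored zero (inj₁ ∈initial)
  linkEdge∉process (suc j) ∈process = linkEdge-¬Anchored (suc j)
    (step-preserves-Anchored j+3≤t (process⊆Anchored (toℕ j) j+3≤t) ∈process (inj₂ (pendant∉linkEdge (suc j))))
    where
    j+3≤t : 3 + toℕ j ≤ t
    j+3≤t = s≤s (s≤s (toℕ<n j))

  process-moving : ∀ i → i < suc t' → process initial i ≢ process initial (suc i)
  process-moving i i<1+t' = subst (λ i → process initial i ≢ process initial (suc i)) (toℕ-fromℕ< i<1+t')
    λ stationary → linkEdge∉process j (subst (linkEdge j ∈F_) (sym stationary) (linkEdge∈process j))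
    where
    j : Leaf
    j = fromℕ< i<1+t'

  runningTime≥t-1 : MAtLeast k F n (suc t')
  runningTime≥t-1 = process-moving⇒MAtLeast initial (suc t') initial-isKGraph process-moving

proposition1p2 : (k t : ℕ) → 3 ≤ k → 2 ≤ t →
    Σ ℕ λ N → (n : ℕ) → N ≤ n → MAtLeast k (kExtension k (Star t)) n (t ∸ 1)
proposition1p2 (suc (suc (suc k'))) (suc (suc t')) _ _ =
  Labels.N t' k' , λ n N≤n → Construction.runningTime≥t-1 t' k' N≤n
proposition1p2 (suc (suc (suc k'))) (suc zero) _ (s≤s ())
proposition1p2 (suc zero)           _          (s≤s ()) _
proposition1p2 (suc (suc zero))     _          (s≤s (s≤s ())) _
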